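{- Let $s,t$ be vertices of the $d$-dimensional Boolean hypercube with $r=d(s,t)$, and let $P_1,P_2$ be $s$–$t$ shortest paths, viewed as permutations of the $r$ coordinates in which $s$ and $t$ differ. Consider the procedure: while there is an index $i\in\{1,\ldots,r-1\}$ such that $P_2^{ -1}(P_1[i])>P_2^{ -1}(P_1[i+1])$, swap $P_1[i]$ and $P_1[i+1]$ in $P_1$. This procedure reconfigures $P_1$ into $P_2$ (each swap being a single reconfiguration step, i.e. a change of exactly one vertex of the path while remaining an $s$–$t$ shortest path), and it does so using the minimum possible number of reconfiguration steps among all reconfiguration sequences from $P_1$ to $P_2$.
   Context: The $d$-dimensional Boolean hypercube has vertex set $\{0,1\}^d$, two vertices adjacent iff they differ in exactly one coordinate. If $s,t$ differ in exactly the coordinates of a set $S$ with $|S|=r$, every $s$–$t$ shortest path flips each coordinate of $S$ exactly once, so it corresponds to a permutation $(i_1,\ldots,i_r)$ of $S$ giving the order in which coordinates are flipped; $P[j]$ denotes the $j$-th entry and $P^{ -1}(x)$ the position of $x$ in $P$. Two $s$–$t$ shortest paths are related by one reconfiguration step if they differ in exactly one vertex; a reconfiguration sequence is a sequence of $s$–$t$ shortest paths, consecutive ones related by one step. -}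

module Defs where

open import Data.Bool using (Bool; true; false; not)
open import Data.Nat using (ℕ; zero; suc; _<_)
open import Data.Fin using (Fin)
open import Data.Fin.Properties using () renaming (_≟_ to _≟ᶠ_)
open import Data.Vec using (Vec; []; _∷_; updateAt)
open import Data.List using (List; []; _∷_; length)
open import Data.Product using (_×_; ∃)
open import Relation.Nullary using (¬_; yes; no)
open import Relation.Binary.PropositionalEquality using (_≡_; _≢_)

Vertex : ℕ → Set
Vertex d = Vec Bool d

flipAt : ∀ {d} → Vertex d → Fin d → Vertex d
flipAt v i = updateAt v i not

-- Hamming distance = graph distance in the hypercube.
hamming : ∀ {d} → Vertex d → Vertex d → ℕ
hamming [] [] = zero
hamming (true ∷ xs) (true ∷ ys) = hamming xs ys
hamming (false ∷ xs) (false ∷ ys) = hamming xs ys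
hamming (true ∷ xs) (false ∷ ys) = suc (hamming xs ys)
hamming (false ∷ xs) (true ∷ ys) = suc (hamming xs ys)

-- A walk starting at v is encoded by the list of coordinates it flips,
-- in order.  'vertices v P' is its vertex sequence.
vertices : ∀ {d} → Vertex d → List (Fin d) → List (Vertex d)
vertices v [] = v ∷ []
vertices v (i ∷ is) = v ∷ vertices (flipAt v i) is

endpoint : ∀ {d} → Vertex d → List (Fin d) → Vertex d
endpoint v [] = v
endpoint v (i ∷ is) = endpoint (flipAt v i) is

IsShortestPath : ∀ {d} → Vertex d → Vertex d → List (Fin d) → Set
IsShortestPath s t P = endpoint s P ≡ t × length P ≡ hamming s t

data DiffOne {A : Set} : List A → List A → Set where
  here  : ∀ {x y xs} → x ≢ y → DiffOne (x ∷ xs) (y ∷ xs)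
  there : ∀ {x xs ys} → DiffOne xs ys → DiffOne (x ∷ xs) (x ∷ ys)

ReconfStep : ∀ {d} → Vertex d → Vertex d → List (Fin d) → List (Fin d) → Set
ReconfStep s t P Q =
  IsShortestPath s t P × IsShortestPath s t Q × DiffOne (vertices s P) (vertices s Q)

data ReconfSeq {d} (s t : Vertex d) : List (Fin d) → List (Fin d) → ℕ → Set where
  done : ∀ {P} → IsShortestPath s t P → ReconfSeq s t P P zero
  step : ∀ {P Q R k} → ReconfStep s t P Q → ReconfSeq s t Q R k → ReconfSeq s t P R (suc k)

-- Position (0-based) of x in a list, i.e. P^{-1}(x); length of the list if absent.
pos : ∀ {d} → List (Fin d) → Fin d → ℕ
pos [] x = zero
pos (y ∷ ys) x with y ≟ᶠ x
... | yes _ = zero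
... | no  _ = suc (pos ys x)

-- One iteration of the procedure's loop (relative to target P₂): swap
-- adjacent entries P[i], P[i+1] with P₂^{-1}(P[i]) > P₂^{-1}(P[i+1]).
data SwapStep {d} (P₂ : List (Fin d)) : List (Fin d) → List (Fin d) → Set where
  here  : ∀ {x y xs} → pos P₂ y < pos P₂ x → SwapStep P₂ (x ∷ y ∷ xs) (y ∷ x ∷ xs)
  there : ∀ {z xs ys} → SwapStep P₂ xs ys → SwapStep P₂ (z ∷ xs) (z ∷ ys)

Halted : ∀ {d} → List (Fin d) → List (Fin d) → Set
Halted P₂ Q = ¬ ∃ (λ R → SwapStep P₂ Q R)

data Run {d} (P₂ : List (Fin d)) : List (Fin d) → List (Fin d) → ℕ → Set where
  done : ∀ {P} → Run P₂ P P zero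
  step : ∀ {P Q R k} → SwapStep P₂ P Q → Run P₂ Q R k → Run P₂ P R (suc k)

-- A shortest s–t path flips every coordinate in which s and t differ exactly once, so
-- the paths are the orderings of that set, and a single-vertex change of a path is
-- exactly a transposition of two adjacent flips.  Counting inversions against P₂, every
-- swap of the procedure removes one inversion while any reconfiguration step removes at
-- most one.  Hence the procedure terminates, after exactly as many swaps as P₁ has
-- inversions, which bounds the length of every reconfiguration sequence from P₁ to P₂.
-- When it halts, its path is sorted by position in P₂ and has the same entries as P₂,
-- so it is P₂.
{-# OPTIONS --safe #-}
module Submission where

open import Defs
open import Data.Bool using (true; false; not; if_then_else_)
open import Data.Bool.Properties using (not-¬; ¬-not; not-involutive) renaming (_≟_ to _≟ᵇ_)
open import Data.Fin using (Fin; zero; suc; _≟_)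
open import Data.List using (List; []; _∷_; length)
open import Data.List.Properties using (∷-injective)
open import Data.List.Membership.Propositional using (_∈_; _∉_)
open import Data.List.Relation.Binary.Subset.Propositional using (_⊆_)
open import Data.List.Relation.Unary.All using (All; []; _∷_) renaming (lookup to All-lookup)
open import Data.List.Relation.Unary.All.Properties.Core using (¬Any⇒All¬)
open import Data.List.Relation.Unary.AllPairs using ([]; _∷_)
open import Data.List.Relation.Unary.Any using (here; there; any?)
open import Data.List.Relation.Unary.Unique.Propositional using (Unique)
open import Data.Nat using (ℕ; zero; suc; _+_; _≤_; _<_; _<?_; z≤n; s≤s)
open import Data.Nat.Induction using (<-wellFounded)
open import Data.Nat.Properties
  using (≤-refl; ≤-reflexive; ≤-trans; <-asym; n≤1+n; m≤n⇒m≤1+n; m≤n+m; n≤0⇒n≡0;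
         +-suc; +-monoˡ-≤; +-monoʳ-≤; module ≤-Reasoning; +-cancelʳ-≤; suc-injective; 1+n≰n; ≮⇒≥)
open import Data.Nat.Tactic.RingSolver using (solve-∀)
open import Data.Product using (_×_; _,_)
open import Data.Vec using ([]; _∷_; lookup)
open import Data.Vec.Properties using (lookup∘updateAt; lookup∘updateAt′; updateAt-commutes)
open import Function using (_∘_; _on_)
open import Induction.WellFounded using (Acc; module Subrelation)
open import Relation.Binary.Construct.On as On using ()
open import Relation.Binary.PropositionalEquality
  using (_≡_; _≢_; refl; sym; trans; cong; subst; subst₂; module ≡-Reasoning)
open import Relation.Nullary using (¬_; yes; no; does; contradiction)
open import Relation.Nullary.Decidable using (dec-true; dec-false)

-- Hypercube geometry

not-≢-self : ∀ b → not b ≢ b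
not-≢-self b e = not-¬ refl (sym e)

lookup-flipAt : ∀ {d} (v : Vertex d) i → lookup (flipAt v i) i ≡ not (lookup v i)
lookup-flipAt v i = lookup∘updateAt i v

lookup-flipAt-≢ : ∀ {d} (v : Vertex d) {i j} → i ≢ j → lookup (flipAt v i) j ≡ lookup v j
lookup-flipAt-≢ v {i} {j} i≢j = lookup∘updateAt′ j i (i≢j ∘ sym) v

flipAt-involutive : ∀ {d} (v : Vertex d) i → flipAt (flipAt v i) i ≡ v
flipAt-involutive (x ∷ v) zero = cong (_∷ v) (not-involutive x)
flipAt-involutive (x ∷ v) (suc i) = cong (x ∷_) (flipAt-involutive v i)

flipAt-comm : ∀ {d} (v : Vertex d) i j → flipAt (flipAt v i) j ≡ flipAt (flipAt v j) i
flipAt-comm v i j with i ≟ j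
... | yes refl = refl
... | no i≢j = updateAt-commutes j i (i≢j ∘ sym) v

flipAt-injective : ∀ {d} (v : Vertex d) {i j} → flipAt v i ≡ flipAt v j → i ≡ j
flipAt-injective v {i} {j} e with i ≟ j
... | yes i≡j = i≡j
... | no i≢j = contradiction
  (trans (sym (lookup-flipAt v i)) (trans (cong (λ w → lookup w i) e) (lookup-flipAt-≢ v (i≢j ∘ sym))))
  (not-≢-self (lookup v i))

flipAt-square : ∀ {d} (v : Vertex d) {a a′ b b′} → a ≢ b → a ≢ a′ →
  flipAt (flipAt v a) a′ ≡ flipAt (flipAt v b) b′ → a′ ≡ b × b′ ≡ a
flipAt-square v {a} {a′} {b} {b′} a≢b a≢a′ e with b′ ≟ a
... | yes refl = flipAt-injective (flipAt v a) (trans e (flipAt-comm v b a)) , refl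
... | no b′≢a = contradiction coordinate-a (not-≢-self (lookup v a))
  where
  open ≡-Reasoning
  coordinate-a : not (lookup v a) ≡ lookup v a
  coordinate-a = begin
    not (lookup v a)                        ≡⟨ sym (lookup-flipAt v a) ⟩
    lookup (flipAt v a) a                   ≡⟨ sym (lookup-flipAt-≢ (flipAt v a) (a≢a′ ∘ sym)) ⟩
    lookup (flipAt (flipAt v a) a′) a       ≡⟨ cong (λ w → lookup w a) e ⟩
    lookup (flipAt (flipAt v b) b′) a       ≡⟨ lookup-flipAt-≢ (flipAt v b) b′≢a ⟩
    lookup (flipAt v b) a                   ≡⟨ lookup-flipAt-≢ v (a≢b ∘ sym) ⟩
    lookup v a                              ∎

hamming-refl : ∀ {d} (v : Vertex d) → hamming v v ≡ 0
hamming-refl [] = refl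
hamming-refl (true ∷ v) = hamming-refl v
hamming-refl (false ∷ v) = hamming-refl v

hamming-flipAt-agree : ∀ {d} (s t : Vertex d) i →
  lookup s i ≡ lookup t i → hamming (flipAt s i) t ≡ suc (hamming s t)
hamming-flipAt-agree (true ∷ s) (.true ∷ t) zero refl = refl
hamming-flipAt-agree (false ∷ s) (.false ∷ t) zero refl = refl
hamming-flipAt-agree (true ∷ s) (true ∷ t) (suc i) e = hamming-flipAt-agree s t i e
hamming-flipAt-agree (true ∷ s) (false ∷ t) (suc i) e = cong suc (hamming-flipAt-agree s t i e)
hamming-flipAt-agree (false ∷ s) (true ∷ t) (suc i) e = cong suc (hamming-flipAt-agree s t i e)
hamming-flipAt-agree (false ∷ s) (false ∷ t) (suc i) e = hamming-flipAt-agree s t i e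

hamming-flipAt-differ : ∀ {d} (s t : Vertex d) i →
  lookup s i ≢ lookup t i → hamming s t ≡ suc (hamming (flipAt s i) t)
hamming-flipAt-differ s t i s≢t = begin
  hamming s t                           ≡⟨ cong (λ w → hamming w t) (sym (flipAt-involutive s i)) ⟩
  hamming (flipAt (flipAt s i) i) t     ≡⟨ hamming-flipAt-agree (flipAt s i) t i flipped-agrees ⟩
  suc (hamming (flipAt s i) t)          ∎
  where
  open ≡-Reasoning
  flipped-agrees : lookup (flipAt s i) i ≡ lookup t i
  flipped-agrees = trans (lookup-flipAt s i) (sym (¬-not (s≢t ∘ sym)))

hamming-≤-flipAt : ∀ {d} (s t : Vertex d) i → hamming s t ≤ suc (hamming (flipAt s i) t)
hamming-≤-flipAt s t i with lookup s i ≟ᵇ lookup t i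
... | yes agree =
  subst (hamming s t ≤_) (cong suc (sym (hamming-flipAt-agree s t i agree))) (m≤n⇒m≤1+n (n≤1+n _))
... | no differ = ≤-reflexive (hamming-flipAt-differ s t i differ)

hamming-endpoint-≤ : ∀ {d} (v : Vertex d) P → hamming v (endpoint v P) ≤ length P
hamming-endpoint-≤ v [] = ≤-reflexive (hamming-refl v)
hamming-endpoint-≤ v (i ∷ P) =
  ≤-trans (hamming-≤-flipAt v _ i) (s≤s (hamming-endpoint-≤ (flipAt v i) P))

lookup-endpoint-∉ : ∀ {d} (v : Vertex d) {P x} → x ∉ P → lookup (endpoint v P) x ≡ lookup v x
lookup-endpoint-∉ v {[]} x∉P = refl
lookup-endpoint-∉ v {i ∷ P} x∉P =
  trans (lookup-endpoint-∉ (flipAt v i) (x∉P ∘ there)) (lookup-flipAt-≢ v (x∉P ∘ here ∘ sym))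

lookup-endpoint-∈ : ∀ {d} (v : Vertex d) {P x} → Unique P → x ∈ P →
  lookup (endpoint v P) x ≡ not (lookup v x)
lookup-endpoint-∈ v {i ∷ P} (i∉P ∷ _) (here refl) =
  trans (lookup-endpoint-∉ (flipAt v i) (λ i∈P → All-lookup i∉P i∈P refl)) (lookup-flipAt v i)
lookup-endpoint-∈ v {i ∷ P} (i∉P ∷ uP) (there x∈P) =
  trans (lookup-endpoint-∈ (flipAt v i) uP x∈P) (cong not (lookup-flipAt-≢ v (All-lookup i∉P x∈P)))

geodesic⇒unique : ∀ {d} (v : Vertex d) P → length P ≡ hamming v (endpoint v P) → Unique P
geodesic⇒unique v [] _ = []
geodesic⇒unique v (i ∷ P) len with lookup v i ≟ᵇ lookup (endpoint (flipAt v i) P) i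
... | yes agree = contradiction
  (subst (_≤ length P) (trans (hamming-flipAt-agree v _ i agree) (cong suc (sym len)))
    (hamming-endpoint-≤ (flipAt v i) P))
  (1+n≰n ∘ ≤-trans (n≤1+n _))
... | no differ = ¬Any⇒All¬ P i∉P ∷ uP
  where
  uP : Unique P
  uP = geodesic⇒unique (flipAt v i) P (suc-injective (trans len (hamming-flipAt-differ v _ i differ)))
  i∉P : i ∉ P
  i∉P i∈P = differ (sym (trans (lookup-endpoint-∈ (flipAt v i) uP i∈P)
    (trans (cong not (lookup-flipAt v i)) (not-involutive (lookup v i)))))

shortestPath⇒unique : ∀ {d} {s t : Vertex d} {P} → IsShortestPath s t P → Unique P
shortestPath⇒unique {s = s} {P = P} (end , len) =
  geodesic⇒unique s P (trans len (cong (hamming s) (sym end)))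

shortestPath-⊆ : ∀ {d} {s t : Vertex d} {P Q} →
  IsShortestPath s t P → IsShortestPath s t Q → P ⊆ Q
shortestPath-⊆ {s = s} {t} {P} {Q} spP@(endP , _) (endQ , _) {x} x∈P with any? (x ≟_) Q
... | yes x∈Q = x∈Q
... | no x∉Q = contradiction (trans (sym flipped) unflipped) (not-≢-self (lookup s x))
  where
  flipped : lookup t x ≡ not (lookup s x)
  flipped = trans (cong (λ w → lookup w x) (sym endP)) (lookup-endpoint-∈ s (shortestPath⇒unique spP) x∈P)
  unflipped : lookup t x ≡ lookup s x
  unflipped = trans (cong (λ w → lookup w x) (sym endQ)) (lookup-endpoint-∉ s x∉Q)

-- Shortest paths and adjacent transpositions

data AdjSwap {A : Set} : List A → List A → Set where
  here  : ∀ {x y xs} → AdjSwap (x ∷ y ∷ xs) (y ∷ x ∷ xs)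
  there : ∀ {z xs ys} → AdjSwap xs ys → AdjSwap (z ∷ xs) (z ∷ ys)

swapStep⇒adjSwap : ∀ {d} {P₂ P Q : List (Fin d)} → SwapStep P₂ P Q → AdjSwap P Q
swapStep⇒adjSwap (here _) = here
swapStep⇒adjSwap (there st) = there (swapStep⇒adjSwap st)

length-adjSwap : ∀ {A : Set} {P Q : List A} → AdjSwap P Q → length P ≡ length Q
length-adjSwap here = refl
length-adjSwap (there sw) = cong suc (length-adjSwap sw)

endpoint-adjSwap : ∀ {d} (v : Vertex d) {P Q} → AdjSwap P Q → endpoint v P ≡ endpoint v Q
endpoint-adjSwap v (here {x} {y} {xs}) = cong (λ w → endpoint w xs) (flipAt-comm v x y)
endpoint-adjSwap v (there {z} sw) = endpoint-adjSwap (flipAt v z) sw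

vertices-adjSwap : ∀ {d} (v : Vertex d) {P Q} → Unique P → AdjSwap P Q →
  DiffOne (vertices v P) (vertices v Q)
vertices-adjSwap v ((x≢y ∷ _) ∷ _) (here {x} {y}) rewrite flipAt-comm v x y =
  there (here (x≢y ∘ flipAt-injective v))
vertices-adjSwap v (_ ∷ uP) (there {z} sw) = there (vertices-adjSwap (flipAt v z) uP sw)

shortestPath-adjSwap : ∀ {d} {s t : Vertex d} {P Q} →
  IsShortestPath s t P → AdjSwap P Q → IsShortestPath s t Q
shortestPath-adjSwap {s = s} (end , len) sw =
  trans (sym (endpoint-adjSwap s sw)) end , trans (sym (length-adjSwap sw)) len

adjSwap⇒reconfStep : ∀ {d} {s t : Vertex d} {P Q} →
  IsShortestPath s t P → AdjSwap P Q → ReconfStep s t P Q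
adjSwap⇒reconfStep {s = s} spP sw =
  spP , shortestPath-adjSwap spP sw , vertices-adjSwap s (shortestPath⇒unique spP) sw

vertices-injective : ∀ {d} {v w : Vertex d} P Q → vertices v P ≡ vertices w Q → v ≡ w × P ≡ Q
vertices-injective [] [] refl = refl , refl
vertices-injective [] (_ ∷ []) ()
vertices-injective [] (_ ∷ _ ∷ _) ()
vertices-injective (_ ∷ []) [] ()
vertices-injective (_ ∷ _ ∷ _) [] ()
vertices-injective {v = v} (i ∷ P) (j ∷ Q) e with ∷-injective e
... | refl , tails with vertices-injective P Q tails
... | flips , refl with flipAt-injective v flips
... | refl = refl , refl

diffOne-∷ : ∀ {A : Set} {x : A} {xs ys} → DiffOne (x ∷ xs) (x ∷ ys) → DiffOne xs ys
diffOne-∷ (here x≢x) = contradiction refl x≢x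
diffOne-∷ (there diff) = diff

diffOne-head : ∀ {A : Set} {x y : A} {xs ys} → DiffOne (x ∷ xs) (y ∷ ys) → x ≢ y → xs ≡ ys
diffOne-head (here _) _ = refl
diffOne-head (there _) x≢x = contradiction refl x≢x

diffOne-diverging⇒adjSwap : ∀ {d} (v : Vertex d) {i j P Q} → i ≢ j → All (i ≢_) P →
  length P ≡ length Q → endpoint (flipAt v i) P ≡ endpoint (flipAt v j) Q →
  DiffOne (vertices (flipAt v i) P) (vertices (flipAt v j) Q) → AdjSwap (i ∷ P) (j ∷ Q)
diffOne-diverging⇒adjSwap v {P = []} {[]} i≢j _ _ end _ = contradiction (flipAt-injective v end) i≢j
diffOne-diverging⇒adjSwap v {i} {j} {i′ ∷ P} {j′ ∷ Q} i≢j (i≢i′ ∷ _) _ _ diff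
  with vertices-injective P Q (diffOne-head diff (i≢j ∘ flipAt-injective v))
... | square , refl with flipAt-square v i≢j i≢i′ square
... | refl , refl = here

diffOne⇒adjSwap : ∀ {d} (v : Vertex d) {P Q} → Unique P → length P ≡ length Q →
  endpoint v P ≡ endpoint v Q → DiffOne (vertices v P) (vertices v Q) → AdjSwap P Q
diffOne⇒adjSwap v {[]} {[]} _ _ _ (there ())
diffOne⇒adjSwap v {[]} {[]} _ _ _ (here v≢v) = contradiction refl v≢v
diffOne⇒adjSwap v {i ∷ P} {j ∷ Q} (i∉P ∷ uP) len end diff with i ≟ j
... | yes refl = there (diffOne⇒adjSwap (flipAt v i) uP (suc-injective len) end (diffOne-∷ diff))
... | no i≢j = diffOne-diverging⇒adjSwap v i≢j i∉P (suc-injective len) end (diffOne-∷ diff)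

reconfStep⇒adjSwap : ∀ {d} {s t : Vertex d} {P Q} → ReconfStep s t P Q → AdjSwap P Q
reconfStep⇒adjSwap {s = s} (spP@(endP , lenP) , (endQ , lenQ) , diff) =
  diffOne⇒adjSwap s (shortestPath⇒unique spP) (trans lenP (sym lenQ)) (trans endP (sym endQ)) diff

-- Inversions

module Inversions {A : Set} (rank : A → ℕ) where

  inverted : A → A → ℕ
  inverted x y = if does (rank y <? rank x) then 1 else 0

  inverted-≤-1 : ∀ x y → inverted x y ≤ 1
  inverted-≤-1 x y with does (rank y <? rank x)
  ... | true = ≤-refl
  ... | false = z≤n

  inversionsWith : A → List A → ℕ
  inversionsWith x [] = 0
  inversionsWith x (y ∷ ys) = inverted x y + inversionsWith x ys

  inversions : List A → ℕ
  inversions [] = 0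
  inversions (x ∷ xs) = inversionsWith x xs + inversions xs

  inversionsWith-adjSwap : ∀ z {xs ys} → AdjSwap xs ys → inversionsWith z xs ≡ inversionsWith z ys
  inversionsWith-adjSwap z (here {x} {y} {xs}) =
    +-left-comm (inverted z x) (inverted z y) (inversionsWith z xs)
    where
    +-left-comm : ∀ a b c → a + (b + c) ≡ b + (a + c)
    +-left-comm = solve-∀
  inversionsWith-adjSwap z (there {w} sw) = cong (inverted z w +_) (inversionsWith-adjSwap z sw)

  inversions-transpose : ∀ x y xs →
    inverted y x + inversions (x ∷ y ∷ xs) ≡ inverted x y + inversions (y ∷ x ∷ xs)
  inversions-transpose x y xs =
    rearrange (inverted x y) (inverted y x) (inversionsWith x xs) (inversionsWith y xs) (inversions xs)
    where
    rearrange : ∀ a b c e f → b + ((a + c) + (e + f)) ≡ a + ((b + e) + (c + f))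
    rearrange = solve-∀

  inversions-∷-adjSwap : ∀ z {xs ys} → AdjSwap xs ys →
    inversions (z ∷ xs) ≡ inversionsWith z ys + inversions xs
  inversions-∷-adjSwap z sw = cong (_+ _) (inversionsWith-adjSwap z sw)

  inversions-adjSwap-≤ : ∀ {xs ys} → AdjSwap xs ys → inversions xs ≤ suc (inversions ys)
  inversions-adjSwap-≤ (here {x} {y} {xs}) = begin
    inversions (x ∷ y ∷ xs)                  ≤⟨ m≤n+m _ (inverted y x) ⟩
    inverted y x + inversions (x ∷ y ∷ xs)   ≡⟨ inversions-transpose x y xs ⟩
    inverted x y + inversions (y ∷ x ∷ xs)   ≤⟨ +-monoˡ-≤ _ (inverted-≤-1 x y) ⟩
    suc (inversions (y ∷ x ∷ xs))            ∎
    where open ≤-Reasoning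
  inversions-adjSwap-≤ (there {z} {xs} {ys} sw) = begin
    inversions (z ∷ xs)                      ≡⟨ inversions-∷-adjSwap z sw ⟩
    inversionsWith z ys + inversions xs      ≤⟨ +-monoʳ-≤ _ (inversions-adjSwap-≤ sw) ⟩
    inversionsWith z ys + suc (inversions ys) ≡⟨ +-suc _ _ ⟩
    suc (inversions (z ∷ ys))                ∎
    where open ≤-Reasoning

  inverted-< : ∀ {x y} → rank y < rank x → inverted x y ≡ 1
  inverted-< {x} {y} y<x rewrite dec-true (rank y <? rank x) y<x = refl

  inverted-≮ : ∀ {x y} → ¬ rank y < rank x → inverted x y ≡ 0
  inverted-≮ {x} {y} y≮x rewrite dec-false (rank y <? rank x) y≮x = refl

  inversions-resolve : ∀ {x y} xs → rank y < rank x →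
    inversions (x ∷ y ∷ xs) ≡ suc (inversions (y ∷ x ∷ xs))
  inversions-resolve {x} {y} xs y<x = begin
    inversions P                  ≡⟨ cong (_+ inversions P) (sym (inverted-≮ (<-asym y<x))) ⟩
    inverted y x + inversions P   ≡⟨ inversions-transpose x y xs ⟩
    inverted x y + inversions Q   ≡⟨ cong (_+ inversions Q) (inverted-< y<x) ⟩
    suc (inversions Q)            ∎
    where
    open ≡-Reasoning
    P Q : List A
    P = x ∷ y ∷ xs
    Q = y ∷ x ∷ xs

-- The sorting procedure

module _ {d} (P₂ : List (Fin d)) where
  open Inversions (pos P₂)

  inversions-swapStep : ∀ {P Q} → SwapStep P₂ P Q → inversions P ≡ suc (inversions Q)
  inversions-swapStep (here {xs = xs} y<x) = inversions-resolve xs y<x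
  inversions-swapStep (there {z} {xs} {ys} st) = begin
    inversions (z ∷ xs)                       ≡⟨ inversions-∷-adjSwap z (swapStep⇒adjSwap st) ⟩
    inversionsWith z ys + inversions xs       ≡⟨ cong (inversionsWith z ys +_) (inversions-swapStep st) ⟩
    inversionsWith z ys + suc (inversions ys) ≡⟨ +-suc _ _ ⟩
    suc (inversions (z ∷ ys))                 ∎
    where open ≡-Reasoning

  swapStep-accessible : ∀ P → Acc (λ Q P → SwapStep P₂ P Q) P
  swapStep-accessible P = Subrelation.accessible {_<₂_ = _<_ on inversions}
    (≤-reflexive ∘ sym ∘ inversions-swapStep) (On.wellFounded inversions <-wellFounded P)

  inversions-run : ∀ {P Q k} → Run P₂ P Q k → inversions P ≡ k + inversions Q
  inversions-run done = refl
  inversions-run (step st run) = trans (inversions-swapStep st) (cong suc (inversions-run run))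

  shortestPath-run : ∀ {s t : Vertex d} {P Q k} → Run P₂ P Q k →
    IsShortestPath s t P → IsShortestPath s t Q
  shortestPath-run done spP = spP
  shortestPath-run (step st run) spP =
    shortestPath-run run (shortestPath-adjSwap spP (swapStep⇒adjSwap st))

inversions-reconfSeq : ∀ {d} (rank : Fin d → ℕ) {s t : Vertex d} {P Q m} →
  ReconfSeq s t P Q m → Inversions.inversions rank P ≤ m + Inversions.inversions rank Q
inversions-reconfSeq rank (done _) = ≤-refl
inversions-reconfSeq rank (step st seq) =
  ≤-trans (inversions-adjSwap-≤ (reconfStep⇒adjSwap st)) (s≤s (inversions-reconfSeq rank seq))
  where open Inversions rank

pos-self : ∀ {d} (p : Fin d) P → pos (p ∷ P) p ≡ 0
pos-self p P with p ≟ p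
... | yes _ = refl
... | no p≢p = contradiction refl p≢p

pos-≢ : ∀ {d} {p y : Fin d} P → p ≢ y → pos (p ∷ P) y ≡ suc (pos P y)
pos-≢ {p = p} {y} P p≢y with p ≟ y
... | yes p≡y = contradiction p≡y p≢y
... | no _ = refl

pos-zero : ∀ {d} {p y : Fin d} P → pos (p ∷ P) y ≡ 0 → p ≡ y
pos-zero {p = p} {y} P at-zero with p ≟ y
... | yes p≡y = p≡y

swapStep-∷ : ∀ {d} {p : Fin d} {P L R} → All (p ≢_) L → SwapStep P L R → SwapStep (p ∷ P) L R
swapStep-∷ {P = P} (p≢x ∷ p≢y ∷ _) (here {x} {y} y<x) =
  here (subst₂ _<_ (sym (pos-≢ P p≢y)) (sym (pos-≢ P p≢x)) (s≤s y<x))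
swapStep-∷ (_ ∷ p∉L) (there st) = there (swapStep-∷ p∉L st)

halted-∷ : ∀ {d} {P₂ : List (Fin d)} {q Q} → Halted P₂ (q ∷ Q) → Halted P₂ Q
halted-∷ h (R , st) = h (_ , there st)

halted-head-≤ : ∀ {d} {P₂ : List (Fin d)} {q Q z} → Halted P₂ (q ∷ Q) → z ∈ Q →
  pos P₂ q ≤ pos P₂ z
halted-head-≤ h (here refl) = ≮⇒≥ (λ z<q → h (_ , here z<q))
halted-head-≤ h (there z∈Q) = ≤-trans (halted-head-≤ h (here refl)) (halted-head-≤ (halted-∷ h) z∈Q)

∈-∷-≢ : ∀ {A : Set} {x y : A} {ys} → x ∈ y ∷ ys → y ≢ x → x ∈ ys
∈-∷-≢ (here x≡y) y≢x = contradiction (sym x≡y) y≢x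
∈-∷-≢ (there x∈ys) _ = x∈ys

halted-head : ∀ {d} {p q : Fin d} {P Q} → Halted (p ∷ P) (q ∷ Q) → p ∈ q ∷ Q → q ≡ p
halted-head h (here p≡q) = sym p≡q
halted-head {p = p} {q} {P} h (there p∈Q) =
  sym (pos-zero P (n≤0⇒n≡0 (subst (pos (p ∷ P) q ≤_) (pos-self p P) (halted-head-≤ h p∈Q))))

halted⇒≡ : ∀ {d} {P₂ Q : List (Fin d)} → Unique Q → Unique P₂ → Q ⊆ P₂ → P₂ ⊆ Q →
  Halted P₂ Q → Q ≡ P₂
halted⇒≡ {P₂ = []} {[]} _ _ _ _ _ = refl
halted⇒≡ {P₂ = []} {q ∷ Q} _ _ Q⊆P₂ _ _ with () ← Q⊆P₂ (here refl)
halted⇒≡ {P₂ = p ∷ P} {[]} _ _ _ P₂⊆Q _ with () ← P₂⊆Q (here refl)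
halted⇒≡ {P₂ = p ∷ P} {q ∷ Q} (q∉Q ∷ uQ) (p∉P ∷ uP) Q⊆P₂ P₂⊆Q h
  with refl ← halted-head h (P₂⊆Q (here refl)) =
  cong (p ∷_) (halted⇒≡ uQ uP Q⊆P P⊆Q (λ (R , st) → h (p ∷ R , there (swapStep-∷ q∉Q st))))
  where
  Q⊆P : Q ⊆ P
  Q⊆P x∈Q = ∈-∷-≢ (Q⊆P₂ (there x∈Q)) (All-lookup q∉Q x∈Q)
  P⊆Q : P ⊆ Q
  P⊆Q x∈P = ∈-∷-≢ (P₂⊆Q (there x∈P)) (All-lookup p∉P x∈P)

mainTheorem6 : ∀ {d} (s t : Vertex d) (P₁ P₂ : List (Fin d)) →
    IsShortestPath s t P₁ → IsShortestPath s t P₂ →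
    -- termination: every execution of the loop is finite
    Acc (λ Q P → SwapStep P₂ P Q) P₁
    -- every swap performed is a single reconfiguration step
    × (∀ {Q R k} → Run P₂ P₁ Q k → SwapStep P₂ Q R → ReconfStep s t Q R)
    -- when the loop stops, the result is P₂, and the number of swaps is
    -- minimum among all reconfiguration sequences from P₁ to P₂
    × (∀ {Q k} → Run P₂ P₁ Q k → Halted P₂ Q →
         Q ≡ P₂ × (∀ {m} → ReconfSeq s t P₁ P₂ m → k ≤ m))
mainTheorem6 s t P₁ P₂ sp₁ sp₂ =
  swapStep-accessible P₂ P₁ ,
  (λ run st → adjSwap⇒reconfStep (shortestPath-run P₂ run sp₁) (swapStep⇒adjSwap st)) ,
  λ run h → let Q≡P₂ = reaches-target run h in Q≡P₂ , swaps-≤ run Q≡P₂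
  where
  open Inversions (pos P₂)

  reaches-target : ∀ {Q k} → Run P₂ P₁ Q k → Halted P₂ Q → Q ≡ P₂
  reaches-target run h = halted⇒≡ (shortestPath⇒unique spQ) (shortestPath⇒unique sp₂)
    (shortestPath-⊆ spQ sp₂) (shortestPath-⊆ sp₂ spQ) h
    where spQ = shortestPath-run P₂ run sp₁

  swaps-≤ : ∀ {Q k m} → Run P₂ P₁ Q k → Q ≡ P₂ → ReconfSeq s t P₁ P₂ m → k ≤ m
  swaps-≤ {k = k} {m} run refl seq = +-cancelʳ-≤ (inversions P₂) k m
    (subst (_≤ m + inversions P₂) (inversions-run P₂ run) (inversions-reconfSeq (pos P₂) seq))
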